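{- The composition, convolution, and smash products of $\operatorname{End}(H)$ restrict to $\operatorname{end}(H)$. Moreover, if $f\in\operatorname{End}(H_p)$, $g\in\operatorname{End}(H_q)$ then \[f\# g\ \in \bigoplus_{n=\max(p,q)}^{p+q} \operatorname{End}(H_n)\] and the top and bottom components of $f\# g$ are \[(f\# g)_{p+q}=f\ast g \text{ \ and, if $p=q$,\ } (f\# g)_p=g\circ f\,.\]
   Context: Let $H=\bigoplus_{n\ge 0}H_n$ be a graded connected Hopf algebra with product $m$ and coproduct $\Delta$ (degree-preserving), and let $\operatorname{end}(H):=\bigoplus_{n\ge0}\operatorname{End}(H_n)$ (grading-preserving linear endomorphisms vanishing on all but finitely many components). On the space $\operatorname{End}(H)$ of linear endomorphisms, for $f,g\in\operatorname{End}(H)$: composition is $f\circ g$; convolution is $f\ast g=m\circ(f\otimes g)\circ\Delta$; and the smash product $f\# g$ is the composite \[H\xrightarrow{\Delta}H^{\otimes2}\xrightarrow{f\otimes1}H^{\otimes2}\xrightarrow{\Delta\otimes1}H^{\otimes3}\xrightarrow{\mathrm{cyclic}}H^{\otimes3}\xrightarrow{1\otimes m}H^{\otimes2}\xrightarrow{1\otimes g}H^{\otimes2}\xrightarrow{m}H,\] where $\mathrm{cyclic}(x\otimes y\otimes z)=y\otimes z\otimes x$. All three products are associative. -}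

module Defs where

open import Level using (Level; _⊔_; suc)
open import Algebra.Bundles using (CommutativeRing)
open import Algebra.Module.Bundles using (Module)
open import Data.Nat as ℕ using (ℕ; zero; _≤_; _∸_)
open import Data.Fin using (Fin; zero; suc)
open import Data.Vec using (Vec; []; _∷_; lookup; _[_]≔_)
open import Data.Vec.Relation.Binary.Pointwise.Inductive using (Pointwise)
open import Data.List using (List; []; _∷_; [_]; _++_; map; foldr; concatMap; upTo)
open import Data.Product using (Σ; ∃; _×_)
open import Relation.Nullary using (¬_)
open import Relation.Binary.PropositionalEquality using (_≡_)

IsField : ∀ {r ℓr} → CommutativeRing r ℓr → Set (r ⊔ ℓr)
IsField K = (¬ (1# ≈ 0#)) × (∀ x → ¬ (x ≈ 0#) → ∃ λ y → x * y ≈ 1#)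
  where open CommutativeRing K

-- Tensor powers of a K-module V, built concretely: an element of
-- V^{⊗n} is represented by a finite formal sum (a list) of pure
-- tensors v₁ ⊗ … ⊗ vₙ (a vector of length n); two representatives are
-- identified by _≋_, the congruence generated by multilinearity and
-- balancing of scalars (the standard construction of ⊗_K).

module TensorOps {r ℓr m ℓm} (K : CommutativeRing r ℓr) (V : Module K m ℓm) where
  open CommutativeRing K using () renaming (Carrier to k)
  open Module V

  M : Set m
  M = Carrierᴹ

  Tens : ℕ → Set m
  Tens n = List (Vec M n)

  infix 4 _≋_
  data _≋_ {n : ℕ} : Tens n → Tens n → Set (r ⊔ m ⊔ ℓm) where
    ≋-refl  : ∀ {xs} → xs ≋ xs
    ≋-sym   : ∀ {xs ys} → xs ≋ ys → ys ≋ xs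
    ≋-trans : ∀ {xs ys zs} → xs ≋ ys → ys ≋ zs → xs ≋ zs
    ≋-++    : ∀ {xs xs′ ys ys′} → xs ≋ xs′ → ys ≋ ys′ → xs ++ ys ≋ xs′ ++ ys′
    ≋-comm  : ∀ xs ys → xs ++ ys ≋ ys ++ xs
    ≋-elem  : ∀ {v w} → Pointwise _≈ᴹ_ v w → [ v ] ≋ [ w ]
    ≋-add   : ∀ (i : Fin n) v x y →
              [ v [ i ]≔ (x +ᴹ y) ] ≋ (v [ i ]≔ x) ∷ (v [ i ]≔ y) ∷ []
    ≋-zero  : ∀ (i : Fin n) v → [ v [ i ]≔ 0ᴹ ] ≋ []
    ≋-scal  : ∀ (i j : Fin n) (c : k) v →
              [ v [ i ]≔ (c *ₗ lookup v i) ] ≋ [ v [ j ]≔ (c *ₗ lookup v j) ]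

  msum : List M → M
  msum = foldr _+ᴹ_ 0ᴹ

  scaleT : k → Tens 2 → Tens 2
  scaleT c = map λ { (x ∷ y ∷ []) → (c *ₗ x) ∷ y ∷ [] }

  _⊗map_ : (M → M) → (M → M) → Tens 2 → Tens 2
  (f ⊗map g) = map λ { (x ∷ y ∷ []) → f x ∷ g y ∷ [] }

  Δ⊗1 : (M → Tens 2) → Tens 2 → Tens 3
  Δ⊗1 Δ = concatMap λ { (x ∷ y ∷ []) → map (λ { (a ∷ b ∷ []) → a ∷ b ∷ y ∷ [] }) (Δ x) }

  1⊗Δ : (M → Tens 2) → Tens 2 → Tens 3
  1⊗Δ Δ = concatMap λ { (x ∷ y ∷ []) → map (λ { (a ∷ b ∷ []) → x ∷ a ∷ b ∷ [] }) (Δ y) }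

  mulT : (M → M → M) → Tens 2 → M
  mulT _∙_ xs = msum (map (λ { (x ∷ y ∷ []) → x ∙ y }) xs)

  prodT : (M → M → M) → Tens 2 → Tens 2 → Tens 2
  prodT _∙_ xs ys =
    concatMap (λ { (a ∷ b ∷ []) → map (λ { (c ∷ d ∷ []) → (a ∙ c) ∷ (b ∙ d) ∷ [] }) ys }) xs

  gradedPartT : (ℕ → M → M) → ℕ → Tens 2 → Tens 2
  gradedPartT π n xs = concatMap (λ i → (π i ⊗map π (n ∸ i)) xs) (upTo (ℕ.suc n))

-- The grading H = ⊕ₙ Hₙ is given by the family of projections πₙ
-- (orthogonal idempotents, locally finitely summing to the identity);
-- Hₙ = image of πₙ.

record IsGradedConnectedHopfAlgebra {r ℓr m ℓm} (K : CommutativeRing r ℓr)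
       (V : Module K m ℓm) : Set (r ⊔ ℓr ⊔ m ⊔ ℓm) where
  open CommutativeRing K using (_+_; _*_; 0#; 1#) renaming (Carrier to k; _≈_ to _≈k_)
  open Module V
  open TensorOps K V
  infixl 7 _∙_
  field
    _∙_        : M → M → M
    1ᴴ         : M
    ∙-cong     : ∀ {x x′ y y′} → x ≈ᴹ x′ → y ≈ᴹ y′ → x ∙ y ≈ᴹ x′ ∙ y′
    ∙-assoc    : ∀ x y z → (x ∙ y) ∙ z ≈ᴹ x ∙ (y ∙ z)
    ∙-identityˡ : ∀ x → 1ᴴ ∙ x ≈ᴹ x
    ∙-identityʳ : ∀ x → x ∙ 1ᴴ ≈ᴹ x
    ∙-distribˡ : ∀ x y z → x ∙ (y +ᴹ z) ≈ᴹ x ∙ y +ᴹ x ∙ z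
    ∙-distribʳ : ∀ x y z → (y +ᴹ z) ∙ x ≈ᴹ y ∙ x +ᴹ z ∙ x
    ∙-scalarˡ  : ∀ c x y → (c *ₗ x) ∙ y ≈ᴹ c *ₗ (x ∙ y)
    ∙-scalarʳ  : ∀ c x y → x ∙ (c *ₗ y) ≈ᴹ c *ₗ (x ∙ y)
    Δ          : M → Tens 2
    Δ-cong     : ∀ {x y} → x ≈ᴹ y → Δ x ≋ Δ y
    Δ-+        : ∀ x y → Δ (x +ᴹ y) ≋ Δ x ++ Δ y
    Δ-scal     : ∀ c x → Δ (c *ₗ x) ≋ scaleT c (Δ x)
    ε          : M → k
    ε-cong     : ∀ {x y} → x ≈ᴹ y → ε x ≈k ε y
    ε-+        : ∀ x y → ε (x +ᴹ y) ≈k ε x + ε y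
    ε-scal     : ∀ c x → ε (c *ₗ x) ≈k c * ε x
    coassoc    : ∀ x → Δ⊗1 Δ (Δ x) ≋ 1⊗Δ Δ (Δ x)
    counitˡ    : ∀ x → msum (map (λ { (a ∷ b ∷ []) → ε a *ₗ b }) (Δ x)) ≈ᴹ x
    counitʳ    : ∀ x → msum (map (λ { (a ∷ b ∷ []) → ε b *ₗ a }) (Δ x)) ≈ᴹ x
    Δ-∙        : ∀ x y → Δ (x ∙ y) ≋ prodT _∙_ (Δ x) (Δ y)
    Δ-1        : Δ 1ᴴ ≋ [ 1ᴴ ∷ 1ᴴ ∷ [] ]
    ε-∙        : ∀ x y → ε (x ∙ y) ≈k ε x * ε y
    ε-1        : ε 1ᴴ ≈k 1#
    S          : M → M
    S-cong     : ∀ {x y} → x ≈ᴹ y → S x ≈ᴹ S y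
    S-+        : ∀ x y → S (x +ᴹ y) ≈ᴹ S x +ᴹ S y
    S-scal     : ∀ c x → S (c *ₗ x) ≈ᴹ c *ₗ S x
    antipodeˡ  : ∀ x → mulT _∙_ ((S ⊗map (λ y → y)) (Δ x)) ≈ᴹ ε x *ₗ 1ᴴ
    antipodeʳ  : ∀ x → mulT _∙_ (((λ y → y) ⊗map S) (Δ x)) ≈ᴹ ε x *ₗ 1ᴴ
    π          : ℕ → M → M
    π-cong     : ∀ n {x y} → x ≈ᴹ y → π n x ≈ᴹ π n y
    π-+        : ∀ n x y → π n (x +ᴹ y) ≈ᴹ π n x +ᴹ π n y
    π-scal     : ∀ n c x → π n (c *ₗ x) ≈ᴹ c *ₗ π n x
    π-idem     : ∀ n x → π n (π n x) ≈ᴹ π n x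
    π-orth     : ∀ m n → ¬ (m ≡ n) → ∀ x → π m (π n x) ≈ᴹ 0ᴹ
    π-decomp   : ∀ x → ∃ λ N → x ≈ᴹ msum (map (λ n → π n x) (upTo N))
    ∙-graded   : ∀ i j x y → π (i ℕ.+ j) (π i x ∙ π j y) ≈ᴹ π i x ∙ π j y
    1-graded   : π 0 1ᴴ ≈ᴹ 1ᴴ
    Δ-graded   : ∀ n x → Δ (π n x) ≋ gradedPartT π n (Δ (π n x))
    ε-graded   : ∀ n x → ε (π (ℕ.suc n) x) ≈k 0#
    connected  : ∀ x → ∃ λ (c : k) → π 0 x ≈ᴹ c *ₗ 1ᴴ

module EndOps {r ℓr m ℓm} (K : CommutativeRing r ℓr) (V : Module K m ℓm)
              (H : IsGradedConnectedHopfAlgebra K V) where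
  open Module V
  open TensorOps K V
  open IsGradedConnectedHopfAlgebra H

  -- f ∈ End(H): f is K-linear
  IsLinear : (M → M) → Set (r ⊔ m ⊔ ℓm)
  IsLinear f = (∀ {x y} → x ≈ᴹ y → f x ≈ᴹ f y)
             × (∀ x y → f (x +ᴹ y) ≈ᴹ f x +ᴹ f y)
             × (∀ c x → f (c *ₗ x) ≈ᴹ c *ₗ f x)

  -- f ∈ end(H) = ⊕ₙ End(Hₙ): linear, grading preserving, and zero on
  -- all but finitely many components
  InEnd : (M → M) → Set (r ⊔ m ⊔ ℓm)
  InEnd f = IsLinear f
          × (∀ n x → f (π n x) ≈ᴹ π n (f x))
          × (∃ λ N → ∀ n → N ≤ n → ∀ x → f (π n x) ≈ᴹ 0ᴹ)

  -- f ∈ End(Hₚ), viewed inside end(H): linear with f = πₚ ∘ f ∘ πₚ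
  InEndAt : ℕ → (M → M) → Set (r ⊔ m ⊔ ℓm)
  InEndAt p f = IsLinear f × (∀ x → f x ≈ᴹ π p (f (π p x)))

  _✶_ : (M → M) → (M → M) → M → M
  (f ✶ g) x = mulT _∙_ ((f ⊗map g) (Δ x))

  cyclic : Tens 3 → Tens 3
  cyclic = map λ { (x ∷ y ∷ z ∷ []) → y ∷ z ∷ x ∷ [] }

  1⊗m : Tens 3 → Tens 2
  1⊗m = map λ { (x ∷ y ∷ z ∷ []) → x ∷ (y ∙ z) ∷ [] }

  _#_ : (M → M) → (M → M) → M → M
  (f # g) x =
    mulT _∙_ (((λ y → y) ⊗map g) (1⊗m (cyclic (Δ⊗1 Δ ((f ⊗map (λ y → y)) (Δ x))))))

{-# OPTIONS --safe #-}
-- Both products are evaluations of bilinear maps on the coproduct: with Δx = Σ a ⊗ b and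
-- Δ(f a) = Σ u ⊗ v, (f ✶ g) x = Σ f a · g b and (f # g) x = Σ v · g (b · u). Since Δ maps Hₙ into
-- ⊕_{i+l=n} Hᵢ ⊗ Hₗ, for x ∈ Hₙ one may take a ∈ Hᵢ, b ∈ Hₗ, u ∈ Hⱼ, v ∈ Hₖ with i + l = n and
-- j + k = i; then v · g (b · u) lies in Hₙ, which gives the grading and the finite support.
-- If f ∈ End(Hₚ) and g ∈ End(H_q), the term vanishes unless i = p and l + j = q, which forces
-- max(p,q) ≤ n ≤ p + q. For n = p + q only j = 0 survives; there u ∈ H₀ = K·1 acts as the scalar
-- ε(u), and the counit axiom collapses Σ ε(u) v to f a, leaving f ✶ g. For n = p = q only l = 0
-- and j = p survive, and the counit axiom applied twice leaves g ∘ f.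
module Submission where

open import Defs
import Level as L
open import Algebra.Bundles using (CommutativeRing; CommutativeMonoid)
open import Algebra.Module.Bundles using (Module)
open import Data.Nat using (ℕ; zero; suc; _+_; _∸_; _<_; _≤_; _⊔_; _≟_; _≤?_; z≤n; s≤s)
open import Data.Nat.Properties using (suc-injective; +-identityʳ; +-comm; +-commutativeSemigroup; m+1+n≢m)
open import Data.Nat.Properties using (≤-trans; m≤m+n; +-monoˡ-≤; +-monoʳ-≤; +-mono-<; <⇒≱; ≮⇒≥; ≰⇒>; >⇒≢; ⊔-lub)
open import Data.Nat.Properties using (m+[n∸m]≡n; m+n∸m≡n)
open import Data.Fin using (zero; suc)
open import Data.Vec using (Vec; []; _∷_)
open import Data.Vec.Relation.Binary.Pointwise.Inductive using ([]; _∷_)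
open import Data.List using ([]; _∷_; _++_; map; concatMap; upTo; applyUpTo)
open import Data.List.Properties using (map-upTo)
open import Data.Product using (_×_; _,_; proj₁; proj₂)
open import Data.Sum using (_⊎_; inj₁; inj₂; [_,_])
open import Data.Empty using (⊥-elim)
open import Function using (_∘_)
open import Relation.Nullary using (¬_; yes; no)
open import Relation.Binary.PropositionalEquality as ≡ using (_≡_; _≢_)
import Algebra.Properties.Group as GroupProperties
import Algebra.Properties.CommutativeSemigroup as CommutativeSemigroupProperties
import Relation.Binary.Reasoning.Setoid as SetoidReasoning

≤-+-split : ∀ {a b c d} → a + b ≤ c + d → a ≤ c ⊎ b ≤ d
≤-+-split {a} {b} {c} {d} a+b≤c+d with a ≤? c
... | yes a≤c = inj₁ a≤c
... | no a≰c  = inj₂ (≮⇒≥ λ d<b → <⇒≱ (+-mono-< (≰⇒> a≰c) d<b) a+b≤c+d)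

-- Degree bookkeeping for a term v ∙ g (b ∙ u) of f # g, where a ⊗ b ∈ Hᵢ ⊗ Hₗ is a component
-- of Δx and u ⊗ v ∈ Hⱼ ⊗ Hₖ one of Δ(f a).

smash-degree : ∀ {i j k l n} → i + l ≡ n → j + k ≡ i → k + (l + j) ≡ n
smash-degree {j = j} {k} {l} ≡.refl ≡.refl = x∙yz≈zx∙y k l j
  where open CommutativeSemigroupProperties +-commutativeSemigroup using (x∙yz≈zx∙y)

smash-degree-bounds : ∀ {j k l n p q} → p + l ≡ n → j + k ≡ p → l + j ≡ q → p ⊔ q ≤ n × n ≤ p + q
smash-degree-bounds {j} {k} {l} ≡.refl ≡.refl ≡.refl =
  ⊔-lub (m≤m+n (j + k) l) (≡.subst (_≤ j + k + l) (+-comm j l) (+-monoˡ-≤ l (m≤m+n j k))) ,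
  +-monoʳ-≤ (j + k) (m≤m+n l j)

module ModuleSums {r ℓr m ℓm} {K : CommutativeRing r ℓr} (V : Module K m ℓm) where
  open Module V
  open TensorOps K V
  open GroupProperties +ᴹ-group using (identityˡ-unique)
  open CommutativeSemigroupProperties (CommutativeMonoid.commutativeSemigroup +ᴹ-commutativeMonoid)
    using (interchange)

  msum-map-cong : ∀ {a} {A : Set a} {h h′ : A → M} → (∀ x → h x ≈ᴹ h′ x) → ∀ xs →
                  msum (map h xs) ≈ᴹ msum (map h′ xs)
  msum-map-cong h≈h′ []       = ≈ᴹ-refl
  msum-map-cong h≈h′ (x ∷ xs) = +ᴹ-cong (h≈h′ x) (msum-map-cong h≈h′ xs)

  ∑< : ℕ → (ℕ → M) → M
  ∑< n h = msum (applyUpTo h n)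

  syntax ∑< n (λ i → x) = ∑[ i < n ] x

  ∑-cong : ∀ n {h h′ : ℕ → M} → (∀ i → i < n → h i ≈ᴹ h′ i) → ∑< n h ≈ᴹ ∑< n h′
  ∑-cong zero    h≈h′ = ≈ᴹ-refl
  ∑-cong (suc n) h≈h′ = +ᴹ-cong (h≈h′ 0 (s≤s z≤n)) (∑-cong n (λ i i<n → h≈h′ (suc i) (s≤s i<n)))

  ∑-0ᴹ : ∀ n {h : ℕ → M} → (∀ i → i < n → h i ≈ᴹ 0ᴹ) → ∑< n h ≈ᴹ 0ᴹ
  ∑-0ᴹ zero    h≈0 = ≈ᴹ-refl
  ∑-0ᴹ (suc n) h≈0 =
    ≈ᴹ-trans (+ᴹ-cong (h≈0 0 (s≤s z≤n)) (∑-0ᴹ n (λ i i<n → h≈0 (suc i) (s≤s i<n)))) (+ᴹ-identityˡ 0ᴹ)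

  ∑-single : ∀ n {h : ℕ → M} k → k < n → (∀ i → i < n → i ≢ k → h i ≈ᴹ 0ᴹ) → ∑< n h ≈ᴹ h k
  ∑-single (suc n) zero    _         others =
    ≈ᴹ-trans (+ᴹ-cong ≈ᴹ-refl (∑-0ᴹ n (λ i i<n → others (suc i) (s≤s i<n) λ ()))) (+ᴹ-identityʳ _)
  ∑-single (suc n) (suc k) (s≤s k<n) others =
    ≈ᴹ-trans (+ᴹ-cong (others 0 (s≤s z≤n) λ ()) (∑-single n k k<n λ i i<n i≢k →
                                                   others (suc i) (s≤s i<n) (i≢k ∘ suc-injective)))
             (+ᴹ-identityˡ _)

  mulT-cong : ∀ {β β′ : M → M → M} → (∀ a b → β a b ≈ᴹ β′ a b) → ∀ t → mulT β t ≈ᴹ mulT β′ t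
  mulT-cong β≈β′ t = msum-map-cong (λ { (a ∷ b ∷ []) → β≈β′ a b }) t

  mulT-0ᴹ : ∀ {β : M → M → M} → (∀ a b → β a b ≈ᴹ 0ᴹ) → ∀ t → mulT β t ≈ᴹ 0ᴹ
  mulT-0ᴹ β≈0 []                  = ≈ᴹ-refl
  mulT-0ᴹ β≈0 ((a ∷ b ∷ []) ∷ t) = ≈ᴹ-trans (+ᴹ-cong (β≈0 a b) (mulT-0ᴹ β≈0 t)) (+ᴹ-identityˡ 0ᴹ)

  mulT-+ᴹ : ∀ (β β′ : M → M → M) t → mulT (λ a b → β a b +ᴹ β′ a b) t ≈ᴹ mulT β t +ᴹ mulT β′ t
  mulT-+ᴹ β β′ []                  = ≈ᴹ-sym (+ᴹ-identityˡ 0ᴹ)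
  mulT-+ᴹ β β′ ((a ∷ b ∷ []) ∷ t) = ≈ᴹ-trans (+ᴹ-cong ≈ᴹ-refl (mulT-+ᴹ β β′ t)) (interchange _ _ _ _)

  mulT-++ : ∀ (β : M → M → M) xs ys → mulT β (xs ++ ys) ≈ᴹ mulT β xs +ᴹ mulT β ys
  mulT-++ β []                   ys = ≈ᴹ-sym (+ᴹ-identityˡ _)
  mulT-++ β ((a ∷ b ∷ []) ∷ xs) ys = ≈ᴹ-trans (+ᴹ-cong ≈ᴹ-refl (mulT-++ β xs ys)) (≈ᴹ-sym (+ᴹ-assoc _ _ _))

  mulT-concatMap : ∀ {a} {A : Set a} (β : M → M → M) (k : A → Tens 2) xs →
                   mulT β (concatMap k xs) ≈ᴹ msum (map (λ x → mulT β (k x)) xs)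
  mulT-concatMap β k []       = ≈ᴹ-refl
  mulT-concatMap β k (x ∷ xs) =
    ≈ᴹ-trans (mulT-++ β (k x) (concatMap k xs)) (+ᴹ-cong ≈ᴹ-refl (mulT-concatMap β k xs))

  mulT-⊗map : ∀ (β : M → M → M) f g t → mulT β ((f ⊗map g) t) ≈ᴹ mulT (λ a b → β (f a) (g b)) t
  mulT-⊗map β f g []                  = ≈ᴹ-refl
  mulT-⊗map β f g ((a ∷ b ∷ []) ∷ t) = +ᴹ-cong ≈ᴹ-refl (mulT-⊗map β f g t)

  module AdditiveMap {F : M → M} (cong : ∀ {x y} → x ≈ᴹ y → F x ≈ᴹ F y)
                     (+ᴹ-homo : ∀ x y → F (x +ᴹ y) ≈ᴹ F x +ᴹ F y) where

    0ᴹ-homo : F 0ᴹ ≈ᴹ 0ᴹ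
    0ᴹ-homo = identityˡ-unique (F 0ᴹ) (F 0ᴹ) (≈ᴹ-trans (≈ᴹ-sym (+ᴹ-homo 0ᴹ 0ᴹ)) (cong (+ᴹ-identityˡ 0ᴹ)))

    msum-homo : ∀ {a} {A : Set a} (h : A → M) xs → F (msum (map h xs)) ≈ᴹ msum (map (F ∘ h) xs)
    msum-homo h []       = 0ᴹ-homo
    msum-homo h (x ∷ xs) = ≈ᴹ-trans (+ᴹ-homo _ _) (+ᴹ-cong ≈ᴹ-refl (msum-homo h xs))

    ∑-homo : ∀ n (h : ℕ → M) → F (∑< n h) ≈ᴹ ∑< n (F ∘ h)
    ∑-homo zero    h = 0ᴹ-homo
    ∑-homo (suc n) h = ≈ᴹ-trans (+ᴹ-homo _ _) (+ᴹ-cong ≈ᴹ-refl (∑-homo n (h ∘ suc)))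

    mulT-homo : ∀ (β : M → M → M) t → F (mulT β t) ≈ᴹ mulT (λ a b → F (β a b)) t
    mulT-homo β t = ≈ᴹ-trans (msum-homo _ t) (msum-map-cong (λ { (a ∷ b ∷ []) → ≈ᴹ-refl }) t)

module _ {r ℓr m ℓm} {K : CommutativeRing r ℓr} {V : Module K m ℓm}
         (H : IsGradedConnectedHopfAlgebra K V) where
  open CommutativeRing K using () renaming (_≈_ to _≈ₖ_)
  module R = CommutativeRing K
  open Module V
  open TensorOps K V
  open IsGradedConnectedHopfAlgebra H
  open EndOps K V H
  open ModuleSums V
  open SetoidReasoning ≈ᴹ-setoid

  module Linear {F : M → M} (F-linear : IsLinear F) where
    cong : ∀ {x y} → x ≈ᴹ y → F x ≈ᴹ F y
    cong = proj₁ F-linear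

    +ᴹ-homo : ∀ x y → F (x +ᴹ y) ≈ᴹ F x +ᴹ F y
    +ᴹ-homo = proj₁ (proj₂ F-linear)

    *ₗ-homo : ∀ c x → F (c *ₗ x) ≈ᴹ c *ₗ F x
    *ₗ-homo = proj₂ (proj₂ F-linear)

    open AdditiveMap cong +ᴹ-homo public

  ∘-isLinear : ∀ {F G} → IsLinear F → IsLinear G → IsLinear (F ∘ G)
  ∘-isLinear F-linear G-linear =
    (F.cong ∘ G.cong) ,
    (λ x y → ≈ᴹ-trans (F.cong (G.+ᴹ-homo x y)) (F.+ᴹ-homo _ _)) ,
    (λ c x → ≈ᴹ-trans (F.cong (G.*ₗ-homo c x)) (F.*ₗ-homo c _))
    where module F = Linear F-linear
          module G = Linear G-linear

  isLinear-resp : ∀ {F G} → (∀ x → F x ≈ᴹ G x) → IsLinear G → IsLinear F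
  isLinear-resp F≈G G-linear =
    (λ x≈y → ≈ᴹ-trans (F≈G _) (≈ᴹ-trans (G.cong x≈y) (≈ᴹ-sym (F≈G _)))) ,
    (λ x y → ≈ᴹ-trans (F≈G _) (≈ᴹ-trans (G.+ᴹ-homo x y) (≈ᴹ-sym (+ᴹ-cong (F≈G x) (F≈G y))))) ,
    (λ c x → ≈ᴹ-trans (F≈G _) (≈ᴹ-trans (G.*ₗ-homo c x) (≈ᴹ-sym (*ₗ-congˡ (F≈G x)))))
    where module G = Linear G-linear

  π-isLinear : ∀ n → IsLinear (π n)
  π-isLinear n = π-cong n , π-+ n , π-scal n

  *ₗ-isLinear : ∀ c → IsLinear (c *ₗ_)
  *ₗ-isLinear c = *ₗ-congˡ , *ₗ-distribˡ c , λ d x → *ₗ-comm c d x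

  ∙-isLinearˡ : ∀ y → IsLinear (_∙ y)
  ∙-isLinearˡ y = (λ x≈x′ → ∙-cong x≈x′ ≈ᴹ-refl) , (λ x x′ → ∙-distribʳ y x x′) , λ c x → ∙-scalarˡ c x y

  ∙-isLinearʳ : ∀ x → IsLinear (x ∙_)
  ∙-isLinearʳ x = ∙-cong ≈ᴹ-refl , ∙-distribˡ x , λ c y → ∙-scalarʳ c x y

  ∙-zeroˡ : ∀ y → 0ᴹ ∙ y ≈ᴹ 0ᴹ
  ∙-zeroˡ y = Linear.0ᴹ-homo (∙-isLinearˡ y)

  ∙-zeroʳ : ∀ x → x ∙ 0ᴹ ≈ᴹ 0ᴹ
  ∙-zeroʳ x = Linear.0ᴹ-homo (∙-isLinearʳ x)

  ε-*ₗ-isLinear : ∀ y → IsLinear (λ x → ε x *ₗ y)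
  ε-*ₗ-isLinear y =
    (λ x≈x′ → *ₗ-congʳ (ε-cong x≈x′)) ,
    (λ x x′ → ≈ᴹ-trans (*ₗ-congʳ (ε-+ x x′)) (*ₗ-distribʳ y _ _)) ,
    (λ c x → ≈ᴹ-trans (*ₗ-congʳ (ε-scal c x)) (*ₗ-assoc c _ y))

  IsBilinear : (M → M → M) → Set (r L.⊔ m L.⊔ ℓm)
  IsBilinear β = (∀ b → IsLinear (λ a → β a b)) × (∀ a → IsLinear (β a))

  ∘₂-isBilinear : ∀ {β F G} → IsBilinear β → IsLinear F → IsLinear G → IsBilinear (λ a b → β (F a) (G b))
  ∘₂-isBilinear {G = G} (β-linearˡ , β-linearʳ) F-linear G-linear =
    (λ b → ∘-isLinear (β-linearˡ (G b)) F-linear) , (λ a → ∘-isLinear (β-linearʳ _) G-linear)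

  ∙-isBilinear : IsBilinear _∙_
  ∙-isBilinear = ∙-isLinearˡ , ∙-isLinearʳ

  mulT-isLinear : ∀ {β : M → M → M → M} → (∀ a b → IsLinear (λ c → β c a b)) → ∀ t →
                  IsLinear (λ c → mulT (β c) t)
  mulT-isLinear β-linear t =
    (λ c≈c′ → mulT-cong (λ a b → Linear.cong (β-linear a b) c≈c′) t) ,
    (λ c c′ → ≈ᴹ-trans (mulT-cong (λ a b → Linear.+ᴹ-homo (β-linear a b) c c′) t) (mulT-+ᴹ _ _ t)) ,
    (λ d c → ≈ᴹ-trans (mulT-cong (λ a b → Linear.*ₗ-homo (β-linear a b) d c) t)
                      (≈ᴹ-sym (Linear.mulT-homo (*ₗ-isLinear d) _ t)))

  module Bilinear {β : M → M → M} (β-bilinear : IsBilinear β) where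
    private
      module First  (b : M) = Linear (proj₁ β-bilinear b)
      module Second (a : M) = Linear (proj₂ β-bilinear a)

    cong₂ : ∀ {a a′ b b′} → a ≈ᴹ a′ → b ≈ᴹ b′ → β a b ≈ᴹ β a′ b′
    cong₂ {a′ = a′} {b = b} a≈a′ b≈b′ = ≈ᴹ-trans (First.cong b a≈a′) (Second.cong a′ b≈b′)

    balanced : ∀ c a b → β (c *ₗ a) b ≈ᴹ β a (c *ₗ b)
    balanced c a b = ≈ᴹ-trans (First.*ₗ-homo b c a) (≈ᴹ-sym (Second.*ₗ-homo a c b))

    mulT-resp-≋ : ∀ {xs ys} → xs ≋ ys → mulT β xs ≈ᴹ mulT β ys
    mulT-resp-≋ ≋-refl            = ≈ᴹ-refl
    mulT-resp-≋ (≋-sym e)         = ≈ᴹ-sym (mulT-resp-≋ e)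
    mulT-resp-≋ (≋-trans e e′)    = ≈ᴹ-trans (mulT-resp-≋ e) (mulT-resp-≋ e′)
    mulT-resp-≋ (≋-++ {xs} {xs′} {ys} {ys′} e e′) = begin
      mulT β (xs ++ ys)          ≈⟨ mulT-++ β xs ys ⟩
      mulT β xs +ᴹ mulT β ys     ≈⟨ +ᴹ-cong (mulT-resp-≋ e) (mulT-resp-≋ e′) ⟩
      mulT β xs′ +ᴹ mulT β ys′   ≈⟨ mulT-++ β xs′ ys′ ⟨
      mulT β (xs′ ++ ys′)        ∎
    mulT-resp-≋ (≋-comm xs ys) =
      ≈ᴹ-trans (mulT-++ β xs ys) (≈ᴹ-trans (+ᴹ-comm _ _) (≈ᴹ-sym (mulT-++ β ys xs)))
    mulT-resp-≋ (≋-elem (a≈a′ ∷ b≈b′ ∷ [])) = +ᴹ-cong (cong₂ a≈a′ b≈b′) ≈ᴹ-refl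
    mulT-resp-≋ (≋-add zero (a ∷ b ∷ []) x y) =
      ≈ᴹ-trans (+ᴹ-cong (First.+ᴹ-homo b x y) ≈ᴹ-refl) (+ᴹ-assoc _ _ _)
    mulT-resp-≋ (≋-add (suc zero) (a ∷ b ∷ []) x y) =
      ≈ᴹ-trans (+ᴹ-cong (Second.+ᴹ-homo a x y) ≈ᴹ-refl) (+ᴹ-assoc _ _ _)
    mulT-resp-≋ (≋-zero zero (a ∷ b ∷ [])) =
      ≈ᴹ-trans (+ᴹ-cong (First.0ᴹ-homo b) ≈ᴹ-refl) (+ᴹ-identityˡ 0ᴹ)
    mulT-resp-≋ (≋-zero (suc zero) (a ∷ b ∷ [])) =
      ≈ᴹ-trans (+ᴹ-cong (Second.0ᴹ-homo a) ≈ᴹ-refl) (+ᴹ-identityˡ 0ᴹ)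
    mulT-resp-≋ (≋-scal zero zero c (a ∷ b ∷ []))             = ≈ᴹ-refl
    mulT-resp-≋ (≋-scal zero (suc zero) c (a ∷ b ∷ []))       = +ᴹ-cong (balanced c a b) ≈ᴹ-refl
    mulT-resp-≋ (≋-scal (suc zero) zero c (a ∷ b ∷ []))       = +ᴹ-cong (≈ᴹ-sym (balanced c a b)) ≈ᴹ-refl
    mulT-resp-≋ (≋-scal (suc zero) (suc zero) c (a ∷ b ∷ [])) = ≈ᴹ-refl

    mulT-scaleT : ∀ c t → mulT β (scaleT c t) ≈ᴹ c *ₗ mulT β t
    mulT-scaleT c []                  = ≈ᴹ-sym (*ₗ-zeroʳ c)
    mulT-scaleT c ((a ∷ b ∷ []) ∷ t) =
      ≈ᴹ-trans (+ᴹ-cong (First.*ₗ-homo b c a) (mulT-scaleT c t)) (≈ᴹ-sym (*ₗ-distribˡ c _ _))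

    mulT∘Δ-isLinear : IsLinear (λ x → mulT β (Δ x))
    mulT∘Δ-isLinear =
      (λ x≈y → mulT-resp-≋ (Δ-cong x≈y)) ,
      (λ x y → ≈ᴹ-trans (mulT-resp-≋ (Δ-+ x y)) (mulT-++ β (Δ x) (Δ y))) ,
      (λ c x → ≈ᴹ-trans (mulT-resp-≋ (Δ-scal c x)) (mulT-scaleT c (Δ x)))

  Homogeneous : ℕ → M → Set ℓm
  Homogeneous n y = π n y ≈ᴹ y

  Graded : (M → M) → Set (m L.⊔ ℓm)
  Graded F = ∀ n x → F (π n x) ≈ᴹ π n (F x)

  PreservesDegree : (M → M) → Set (m L.⊔ ℓm)
  PreservesDegree F = ∀ n {y} → Homogeneous n y → Homogeneous n (F y)

  VanishesFrom : ℕ → (M → M) → Set (m L.⊔ ℓm)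
  VanishesFrom N F = ∀ n → N ≤ n → ∀ x → F (π n x) ≈ᴹ 0ᴹ

  homogeneous-resp : ∀ {n y z} → y ≈ᴹ z → Homogeneous n y → Homogeneous n z
  homogeneous-resp {n} y≈z y∈Hn = ≈ᴹ-trans (π-cong n (≈ᴹ-sym y≈z)) (≈ᴹ-trans y∈Hn y≈z)

  ∙-homogeneous : ∀ {i j y z} → Homogeneous i y → Homogeneous j z → Homogeneous (i + j) (y ∙ z)
  ∙-homogeneous {i} {j} {y} {z} y∈Hi z∈Hj = begin
    π (i + j) (y ∙ z)          ≈⟨ π-cong (i + j) (∙-cong y∈Hi z∈Hj) ⟨
    π (i + j) (π i y ∙ π j z)  ≈⟨ ∙-graded i j y z ⟩
    π i y ∙ π j z              ≈⟨ ∙-cong y∈Hi z∈Hj ⟩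
    y ∙ z                      ∎

  π-other : ∀ {i n y} → Homogeneous n y → i ≢ n → π i y ≈ᴹ 0ᴹ
  π-other {i} {n} {y} y∈Hn i≢n = ≈ᴹ-trans (π-cong i (≈ᴹ-sym y∈Hn)) (π-orth i n i≢n y)

  mulT-homogeneous : ∀ {n β} → (∀ a b → Homogeneous n (β a b)) → ∀ t → Homogeneous n (mulT β t)
  mulT-homogeneous {n} β∈Hn t = ≈ᴹ-trans (Linear.mulT-homo (π-isLinear n) _ t) (mulT-cong β∈Hn t)

  ∑-homogeneous : ∀ {n} N {h} → (∀ i → i < N → Homogeneous n (h i)) → Homogeneous n (∑< N h)
  ∑-homogeneous {n} N h∈Hn = ≈ᴹ-trans (Linear.∑-homo (π-isLinear n) N _) (∑-cong N h∈Hn)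

  vanishes-homogeneous : ∀ {F N n y} → IsLinear F → VanishesFrom N F → N ≤ n → Homogeneous n y → F y ≈ᴹ 0ᴹ
  vanishes-homogeneous {n = n} {y} F-linear F-vanishes N≤n y∈Hn =
    ≈ᴹ-trans (Linear.cong F-linear (≈ᴹ-sym y∈Hn)) (F-vanishes n N≤n y)

  components-ext : ∀ {F G} → IsLinear F → IsLinear G → (∀ n x → F (π n x) ≈ᴹ G (π n x)) → ∀ x → F x ≈ᴹ G x
  components-ext {F} {G} F-linear G-linear F≈G x with π-decomp x
  ... | N , x≈∑πx = begin
    F x                                    ≈⟨ F.cong x≈∑πx ⟩
    F (msum (map (λ n → π n x) (upTo N)))  ≈⟨ F.msum-homo _ (upTo N) ⟩
    msum (map (λ n → F (π n x)) (upTo N))  ≈⟨ msum-map-cong (λ n → F≈G n x) (upTo N) ⟩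
    msum (map (λ n → G (π n x)) (upTo N))  ≈⟨ G.msum-homo _ (upTo N) ⟨
    G (msum (map (λ n → π n x) (upTo N)))  ≈⟨ G.cong x≈∑πx ⟨
    G x                                    ∎
    where module F = Linear F-linear
          module G = Linear G-linear

  graded⇒preservesDegree : ∀ {F} → IsLinear F → Graded F → PreservesDegree F
  graded⇒preservesDegree F-linear F-graded n {y} y∈Hn =
    ≈ᴹ-trans (≈ᴹ-sym (F-graded n y)) (Linear.cong F-linear y∈Hn)

  preservesDegree⇒graded : ∀ {F} → IsLinear F → PreservesDegree F → Graded F
  preservesDegree⇒graded {F} F-linear F-preserves n =
    components-ext (∘-isLinear F-linear (π-isLinear n)) (∘-isLinear (π-isLinear n) F-linear) component
    where
    module F = Linear F-linear
    component : ∀ k x → F (π n (π k x)) ≈ᴹ π n (F (π k x))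
    component k x with n ≟ k
    ... | yes ≡.refl = ≈ᴹ-trans (F.cong (π-idem n x)) (≈ᴹ-sym (F-preserves n (π-idem n x)))
    ... | no n≢k     = ≈ᴹ-trans (F.cong (π-orth n k n≢k x))
                         (≈ᴹ-trans F.0ᴹ-homo (≈ᴹ-sym (π-other (F-preserves k (π-idem k x)) n≢k)))

  module _ {β : M → M → M} (β-bilinear : IsBilinear β) {p w} (w∈Hp : Homogeneous p w) where
    open Bilinear using (mulT-resp-≋)

    Δ-split : mulT β (Δ w) ≈ᴹ ∑[ i < suc p ] mulT (λ a b → β (π i a) (π (p ∸ i) b)) (Δ w)
    Δ-split = begin
      mulT β (Δ w)                                       ≈⟨ mulT-resp-≋ β-bilinear (Δ-cong (≈ᴹ-sym w∈Hp)) ⟩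
      mulT β (Δ (π p w))                                 ≈⟨ mulT-resp-≋ β-bilinear (Δ-graded p w) ⟩
      mulT β (gradedPartT π p (Δ (π p w)))               ≈⟨ mulT-concatMap β bidegree (upTo (suc p)) ⟩
      msum (map (λ i → mulT β (bidegree i)) (upTo (suc p)))
        ≈⟨ ≈ᴹ-reflexive (≡.cong msum (map-upTo _ (suc p))) ⟩
      ∑[ i < suc p ] mulT β (bidegree i)                 ≈⟨ ∑-cong (suc p) (λ i _ → component i) ⟩
      ∑[ i < suc p ] mulT (λ a b → β (π i a) (π (p ∸ i) b)) (Δ w) ∎
      where
      bidegree : ℕ → Tens 2
      bidegree i = (π i ⊗map π (p ∸ i)) (Δ (π p w))
      component : ∀ i → mulT β (bidegree i) ≈ᴹ mulT (λ a b → β (π i a) (π (p ∸ i) b)) (Δ w)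
      component i = ≈ᴹ-trans (mulT-⊗map β (π i) (π (p ∸ i)) (Δ (π p w)))
        (mulT-resp-≋ (∘₂-isBilinear β-bilinear (π-isLinear i) (π-isLinear (p ∸ i))) (Δ-cong w∈Hp))

    Δ-vanishes : (∀ i j → i + j ≡ p → ∀ a b → β (π i a) (π j b) ≈ᴹ 0ᴹ) → mulT β (Δ w) ≈ᴹ 0ᴹ
    Δ-vanishes β≈0 = ≈ᴹ-trans Δ-split (∑-0ᴹ (suc p) λ { i (s≤s i≤p) →
      mulT-0ᴹ (β≈0 i (p ∸ i) (m+[n∸m]≡n i≤p)) (Δ w) })

    Δ-homogeneous : ∀ {n} → (∀ i j → i + j ≡ p → ∀ a b → Homogeneous n (β (π i a) (π j b))) →
                    Homogeneous n (mulT β (Δ w))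
    Δ-homogeneous β∈Hn = homogeneous-resp (≈ᴹ-sym Δ-split) (∑-homogeneous (suc p) λ { i (s≤s i≤p) →
      mulT-homogeneous (β∈Hn i (p ∸ i) (m+[n∸m]≡n i≤p)) (Δ w) })

    Δ-single : ∀ k l → k + l ≡ p → (∀ i j → i + j ≡ p → i ≢ k → ∀ a b → β (π i a) (π j b) ≈ᴹ 0ᴹ) →
               mulT β (Δ w) ≈ᴹ mulT (λ a b → β (π k a) (π l b)) (Δ w)
    Δ-single k l k+l≡p others = begin
      mulT β (Δ w)                                                ≈⟨ Δ-split ⟩
      ∑[ i < suc p ] mulT (λ a b → β (π i a) (π (p ∸ i) b)) (Δ w) ≈⟨ ∑-single (suc p) k k<1+p others′ ⟩
      mulT (λ a b → β (π k a) (π (p ∸ k) b)) (Δ w)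
        ≡⟨ ≡.cong (λ j → mulT (λ a b → β (π k a) (π j b)) (Δ w)) p∸k≡l ⟩
      mulT (λ a b → β (π k a) (π l b)) (Δ w)                      ∎
      where
      k<1+p : k < suc p
      k<1+p = s≤s (≡.subst (k ≤_) k+l≡p (m≤m+n k l))
      p∸k≡l : p ∸ k ≡ l
      p∸k≡l = ≡.trans (≡.cong (_∸ k) (≡.sym k+l≡p)) (m+n∸m≡n k l)
      others′ : ∀ i → i < suc p → i ≢ k → mulT (λ a b → β (π i a) (π (p ∸ i) b)) (Δ w) ≈ᴹ 0ᴹ
      others′ i (s≤s i≤p) i≢k = mulT-0ᴹ (others i (p ∸ i) (m+[n∸m]≡n i≤p) i≢k) (Δ w)

  counitˡ-homogeneous : ∀ {p w} → Homogeneous p w → mulT (λ a b → ε (π 0 a) *ₗ π p b) (Δ w) ≈ᴹ w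
  counitˡ-homogeneous {p} {w} w∈Hp =
    ≈ᴹ-trans (≈ᴹ-sym (Δ-single ε-*ₗ-isBilinear w∈Hp 0 p ≡.refl positive))
             (≈ᴹ-trans (msum-map-cong (λ { (a ∷ b ∷ []) → ≈ᴹ-refl }) (Δ w)) (counitˡ w))
    where
    ε-*ₗ-isBilinear : IsBilinear (λ a b → ε a *ₗ b)
    ε-*ₗ-isBilinear = ε-*ₗ-isLinear , λ a → *ₗ-isLinear (ε a)
    positive : ∀ i j → i + j ≡ p → i ≢ 0 → ∀ a b → ε (π i a) *ₗ π j b ≈ᴹ 0ᴹ
    positive zero    _ _ 0≢0 = ⊥-elim (0≢0 ≡.refl)
    positive (suc i) _ _ _   = λ a b → ≈ᴹ-trans (*ₗ-congʳ (ε-graded i a)) (*ₗ-zeroˡ _)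

  counitʳ-homogeneous : ∀ {p w} → Homogeneous p w → mulT (λ a b → ε (π 0 b) *ₗ π p a) (Δ w) ≈ᴹ w
  counitʳ-homogeneous {p} {w} w∈Hp =
    ≈ᴹ-trans (≈ᴹ-sym (Δ-single *ₗ-ε-isBilinear w∈Hp p 0 (+-identityʳ p) positive))
             (≈ᴹ-trans (msum-map-cong (λ { (a ∷ b ∷ []) → ≈ᴹ-refl }) (Δ w)) (counitʳ w))
    where
    *ₗ-ε-isBilinear : IsBilinear (λ a b → ε b *ₗ a)
    *ₗ-ε-isBilinear = (λ b → *ₗ-isLinear (ε b)) , ε-*ₗ-isLinear
    positive : ∀ i j → i + j ≡ p → i ≢ p → ∀ a b → ε (π j b) *ₗ π i a ≈ᴹ 0ᴹ
    positive i zero    i+0≡p i≢p = ⊥-elim (i≢p (≡.trans (≡.sym (+-identityʳ i)) i+0≡p))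
    positive i (suc j) _     _   = λ a b → ≈ᴹ-trans (*ₗ-congʳ (ε-graded j b)) (*ₗ-zeroˡ _)

  π₀≈ε*ₗ1ᴴ : ∀ u → π 0 u ≈ᴹ ε (π 0 u) *ₗ 1ᴴ
  π₀≈ε*ₗ1ᴴ u with connected u
  ... | c , π₀u≈c1ᴴ = ≈ᴹ-trans π₀u≈c1ᴴ (*ₗ-congʳ (R.sym ε≈c))
    where
    ε≈c : ε (π 0 u) ≈ₖ c
    ε≈c = R.trans (ε-cong π₀u≈c1ᴴ) (R.trans (ε-scal c 1ᴴ) (R.trans (R.*-congˡ ε-1) (R.*-identityʳ c)))

  π₀-∙ : ∀ u y → π 0 u ∙ y ≈ᴹ ε (π 0 u) *ₗ y
  π₀-∙ u y = ≈ᴹ-trans (∙-cong (π₀≈ε*ₗ1ᴴ u) ≈ᴹ-refl) (≈ᴹ-trans (∙-scalarˡ _ 1ᴴ y) (*ₗ-congˡ (∙-identityˡ y)))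

  ∙-π₀ : ∀ y u → y ∙ π 0 u ≈ᴹ ε (π 0 u) *ₗ y
  ∙-π₀ y u = ≈ᴹ-trans (∙-cong ≈ᴹ-refl (π₀≈ε*ₗ1ᴴ u)) (≈ᴹ-trans (∙-scalarʳ _ y 1ᴴ) (*ₗ-congˡ (∙-identityʳ y)))

  smashInner : (M → M) → M → M → M → M
  smashInner g b u v = v ∙ g (b ∙ u)

  smashForm : (M → M) → (M → M) → M → M → M
  smashForm f g a b = mulT (smashInner g b) (Δ (f a))

  #≈mulT-smashForm : ∀ f g x → (f # g) x ≈ᴹ mulT (smashForm f g) (Δ x)
  #≈mulT-smashForm f g x = go (Δ x)
    where
    tail : Tens 3 → M
    tail s = mulT _∙_ (((λ y → y) ⊗map g) (1⊗m (cyclic s)))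
    tail-++ : ∀ s s′ → tail (s ++ s′) ≈ᴹ tail s +ᴹ tail s′
    tail-++ []      s′ = ≈ᴹ-sym (+ᴹ-identityˡ _)
    tail-++ (_ ∷ s) s′ = ≈ᴹ-trans (+ᴹ-cong ≈ᴹ-refl (tail-++ s s′)) (≈ᴹ-sym (+ᴹ-assoc _ _ _))
    -- φ stands for the anonymous map u ⊗ v ↦ u ⊗ v ⊗ b inside Δ⊗1, which cannot be named.
    tail-map : ∀ b (φ : Vec M 2 → Vec M 3) → (∀ u v → φ (u ∷ v ∷ []) ≡ u ∷ v ∷ b ∷ []) →
               ∀ t → tail (map φ t) ≈ᴹ mulT (smashInner g b) t
    tail-map b φ φ≡ []                  = ≈ᴹ-refl
    tail-map b φ φ≡ ((u ∷ v ∷ []) ∷ t) rewrite φ≡ u v = +ᴹ-cong ≈ᴹ-refl (tail-map b φ φ≡ t)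
    go : ∀ t → tail (Δ⊗1 Δ ((f ⊗map (λ y → y)) t)) ≈ᴹ mulT (smashForm f g) t
    go []                  = ≈ᴹ-refl
    go ((a ∷ b ∷ []) ∷ t) = ≈ᴹ-trans (tail-++ (map _ (Δ (f a))) _)
                                     (+ᴹ-cong (tail-map b _ (λ _ _ → ≡.refl) (Δ (f a))) (go t))

  smashInner-isBilinear : ∀ {g} → IsLinear g → ∀ b → IsBilinear (smashInner g b)
  smashInner-isBilinear g-linear b =
    (λ v → ∘-isLinear (∙-isLinearʳ v) (∘-isLinear g-linear (∙-isLinearʳ b))) , (λ u → ∙-isLinearˡ _)

  smashForm-isBilinear : ∀ {f g} → IsLinear f → IsLinear g → IsBilinear (smashForm f g)
  smashForm-isBilinear {f} f-linear g-linear =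
    (λ b → ∘-isLinear (Bilinear.mulT∘Δ-isLinear (smashInner-isBilinear g-linear b)) f-linear) ,
    (λ a → mulT-isLinear (λ u v → ∘-isLinear (∙-isLinearʳ v) (∘-isLinear g-linear (∙-isLinearˡ u)))
                         (Δ (f a)))

  smashForm-0ᴹ : ∀ {f g a} → IsLinear g → f a ≈ᴹ 0ᴹ → ∀ b → smashForm f g a b ≈ᴹ 0ᴹ
  smashForm-0ᴹ g-linear fa≈0 b = ≈ᴹ-trans (F.cong fa≈0) F.0ᴹ-homo
    where module F = Linear (Bilinear.mulT∘Δ-isLinear (smashInner-isBilinear g-linear b))

  convolution-isBilinear : ∀ {f g} → IsLinear f → IsLinear g → IsBilinear (λ a b → f a ∙ g b)
  convolution-isBilinear = ∘₂-isBilinear ∙-isBilinear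

  ✶≈mulT : ∀ f g x → (f ✶ g) x ≈ᴹ mulT (λ a b → f a ∙ g b) (Δ x)
  ✶≈mulT f g x = mulT-⊗map _∙_ f g (Δ x)

  ✶-isLinear : ∀ {f g} → IsLinear f → IsLinear g → IsLinear (f ✶ g)
  ✶-isLinear {f} {g} f-linear g-linear =
    isLinear-resp (✶≈mulT f g) (Bilinear.mulT∘Δ-isLinear (convolution-isBilinear f-linear g-linear))

  #-isLinear : ∀ {f g} → IsLinear f → IsLinear g → IsLinear (f # g)
  #-isLinear {f} {g} f-linear g-linear =
    isLinear-resp (#≈mulT-smashForm f g) (Bilinear.mulT∘Δ-isLinear (smashForm-isBilinear f-linear g-linear))

  ✶-preservesDegree : ∀ {f g} → IsLinear f → IsLinear g → PreservesDegree f → PreservesDegree g →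
                      PreservesDegree (f ✶ g)
  ✶-preservesDegree {f} {g} f-linear g-linear f-preserves g-preserves n {x} x∈Hn =
    homogeneous-resp (≈ᴹ-sym (✶≈mulT f g x))
      (Δ-homogeneous (convolution-isBilinear f-linear g-linear) x∈Hn λ i j i+j≡n a b →
        ≡.subst (λ d → Homogeneous d _) i+j≡n
          (∙-homogeneous (f-preserves i (π-idem i a)) (g-preserves j (π-idem j b))))

  #-preservesDegree : ∀ {f g} → IsLinear f → IsLinear g → PreservesDegree f → PreservesDegree g →
                      PreservesDegree (f # g)
  #-preservesDegree {f} {g} f-linear g-linear f-preserves g-preserves n {x} x∈Hn =
    homogeneous-resp (≈ᴹ-sym (#≈mulT-smashForm f g x))
      (Δ-homogeneous (smashForm-isBilinear f-linear g-linear) x∈Hn λ i l i+l≡n a b →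
        Δ-homogeneous (smashInner-isBilinear g-linear (π l b)) (f-preserves i (π-idem i a))
          λ j k j+k≡i u v →
          ≡.subst (λ d → Homogeneous d _) (smash-degree {j = j} {k} i+l≡n j+k≡i)
            (∙-homogeneous (π-idem k v) (g-preserves (l + j) (∙-homogeneous (π-idem l b) (π-idem j u)))))

  ✶-vanishesFrom : ∀ {f g Nf Ng} → IsLinear f → IsLinear g → VanishesFrom Nf f → VanishesFrom Ng g →
                   VanishesFrom (Nf + Ng) (f ✶ g)
  ✶-vanishesFrom {f} {g} {Nf} {Ng} f-linear g-linear f-vanishes g-vanishes n Nf+Ng≤n x =
    ≈ᴹ-trans (✶≈mulT f g (π n x)) (Δ-vanishes (convolution-isBilinear f-linear g-linear) (π-idem n x) term)
    where
    term : ∀ i j → i + j ≡ n → ∀ a b → f (π i a) ∙ g (π j b) ≈ᴹ 0ᴹ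
    term i j i+j≡n a b with ≤-+-split (≡.subst (Nf + Ng ≤_) (≡.sym i+j≡n) Nf+Ng≤n)
    ... | inj₁ Nf≤i = ≈ᴹ-trans (∙-cong (f-vanishes i Nf≤i a) ≈ᴹ-refl) (∙-zeroˡ _)
    ... | inj₂ Ng≤j = ≈ᴹ-trans (∙-cong ≈ᴹ-refl (g-vanishes j Ng≤j b)) (∙-zeroʳ _)

  #-vanishesFrom : ∀ {f g Nf Ng} → IsLinear f → IsLinear g → PreservesDegree f →
                   VanishesFrom Nf f → VanishesFrom Ng g → VanishesFrom (Nf + Ng) (f # g)
  #-vanishesFrom {f} {g} {Nf} {Ng} f-linear g-linear f-preserves f-vanishes g-vanishes n Nf+Ng≤n x =
    ≈ᴹ-trans (#≈mulT-smashForm f g (π n x))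
             (Δ-vanishes (smashForm-isBilinear f-linear g-linear) (π-idem n x) term)
    where
    term : ∀ i l → i + l ≡ n → ∀ a b → smashForm f g (π i a) (π l b) ≈ᴹ 0ᴹ
    term i l i+l≡n a b with ≤-+-split (≡.subst (Nf + Ng ≤_) (≡.sym i+l≡n) Nf+Ng≤n)
    ... | inj₁ Nf≤i = smashForm-0ᴹ {f = f} g-linear (f-vanishes i Nf≤i a) (π l b)
    ... | inj₂ Ng≤l =
      Δ-vanishes (smashInner-isBilinear g-linear (π l b)) (f-preserves i (π-idem i a)) λ j k _ u v →
        ≈ᴹ-trans (∙-cong ≈ᴹ-refl (vanishes-homogeneous g-linear g-vanishes (≤-trans Ng≤l (m≤m+n l j))
                                    (∙-homogeneous (π-idem l b) (π-idem j u))))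
                 (∙-zeroʳ _)

  ∘-inEnd : ∀ {f g} → InEnd f → InEnd g → InEnd (f ∘ g)
  ∘-inEnd {g = g} (f-linear , f-graded , _) (g-linear , g-graded , Ng , g-vanishes) =
    ∘-isLinear f-linear g-linear ,
    (λ n x → ≈ᴹ-trans (F.cong (g-graded n x)) (f-graded n (g x))) ,
    Ng , λ n Ng≤n x → ≈ᴹ-trans (F.cong (g-vanishes n Ng≤n x)) F.0ᴹ-homo
    where module F = Linear f-linear

  ✶-inEnd : ∀ {f g} → InEnd f → InEnd g → InEnd (f ✶ g)
  ✶-inEnd (f-linear , f-graded , Nf , f-vanishes) (g-linear , g-graded , Ng , g-vanishes) =
    ✶-isLinear f-linear g-linear ,
    preservesDegree⇒graded (✶-isLinear f-linear g-linear)
      (✶-preservesDegree f-linear g-linear (graded⇒preservesDegree f-linear f-graded)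
                                           (graded⇒preservesDegree g-linear g-graded)) ,
    Nf + Ng , ✶-vanishesFrom f-linear g-linear f-vanishes g-vanishes

  #-inEnd : ∀ {f g} → InEnd f → InEnd g → InEnd (f # g)
  #-inEnd {f} (f-linear , f-graded , Nf , f-vanishes) (g-linear , g-graded , Ng , g-vanishes) =
    #-isLinear f-linear g-linear ,
    preservesDegree⇒graded (#-isLinear f-linear g-linear)
      (#-preservesDegree f-linear g-linear f-preserves (graded⇒preservesDegree g-linear g-graded)) ,
    Nf + Ng , #-vanishesFrom f-linear g-linear f-preserves f-vanishes g-vanishes
    where
    f-preserves : PreservesDegree f
    f-preserves = graded⇒preservesDegree f-linear f-graded

  module EndAt {p f} (f∈End-p : InEndAt p f) where
    linear : IsLinear f
    linear = proj₁ f∈End-p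

    open Linear linear public

    private
      f≈πfπ : ∀ x → f x ≈ᴹ π p (f (π p x))
      f≈πfπ = proj₂ f∈End-p

    homogeneous : ∀ x → Homogeneous p (f x)
    homogeneous x = begin
      π p (f x)              ≈⟨ π-cong p (f≈πfπ x) ⟩
      π p (π p (f (π p x)))  ≈⟨ π-idem p _ ⟩
      π p (f (π p x))        ≈⟨ f≈πfπ x ⟨
      f x                    ∎

    vanishes-off : ∀ {n y} → n ≢ p → Homogeneous n y → f y ≈ᴹ 0ᴹ
    vanishes-off {n} {y} n≢p y∈Hn = begin
      f y              ≈⟨ f≈πfπ y ⟩
      π p (f (π p y))  ≈⟨ π-cong p (cong (π-other y∈Hn (n≢p ∘ ≡.sym))) ⟩
      π p (f 0ᴹ)       ≈⟨ π-cong p 0ᴹ-homo ⟩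
      π p 0ᴹ           ≈⟨ Linear.0ᴹ-homo (π-isLinear p) ⟩
      0ᴹ               ∎

    absorbs-π : ∀ x → f (π p x) ≈ᴹ f x
    absorbs-π x = begin
      f (π p x)              ≈⟨ f≈πfπ (π p x) ⟩
      π p (f (π p (π p x)))  ≈⟨ π-cong p (cong (π-idem p x)) ⟩
      π p (f (π p x))        ≈⟨ f≈πfπ x ⟨
      f x                    ∎

    inEnd : InEnd f
    inEnd = linear , graded , suc p , λ n p<n x → vanishes-off (>⇒≢ p<n) (π-idem n x)
      where
      graded : Graded f
      graded n x with n ≟ p
      ... | yes ≡.refl = ≈ᴹ-trans (absorbs-π x) (≈ᴹ-sym (homogeneous x))
      ... | no n≢p     = ≈ᴹ-trans (vanishes-off n≢p (π-idem n x)) (≈ᴹ-sym (π-other (homogeneous x) n≢p))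

  smashInner-top : ∀ {p q g w y} → InEndAt q g → Homogeneous p w → Homogeneous q y →
                   mulT (smashInner g y) (Δ w) ≈ᴹ w ∙ g y
  smashInner-top {p} {q} {g} {w} {y} g∈End-q w∈Hp y∈Hq = begin
    mulT (smashInner g y) (Δ w)
      ≈⟨ Δ-single (smashInner-isBilinear G.linear y) w∈Hp 0 p ≡.refl higher ⟩
    mulT (λ u v → π p v ∙ g (y ∙ π 0 u)) (Δ w)       ≈⟨ mulT-cong unit (Δ w) ⟩
    mulT (λ u v → (ε (π 0 u) *ₗ π p v) ∙ g y) (Δ w)  ≈⟨ Linear.mulT-homo (∙-isLinearˡ (g y)) _ (Δ w) ⟨
    mulT (λ u v → ε (π 0 u) *ₗ π p v) (Δ w) ∙ g y    ≈⟨ ∙-cong (counitˡ-homogeneous w∈Hp) ≈ᴹ-refl ⟩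
    w ∙ g y                                          ∎
    where
    module G = EndAt g∈End-q
    higher : ∀ j k → j + k ≡ p → j ≢ 0 → ∀ u v → π k v ∙ g (y ∙ π j u) ≈ᴹ 0ᴹ
    higher zero    _ _ 0≢0 = ⊥-elim (0≢0 ≡.refl)
    higher (suc j) _ _ _   = λ u v →
      ≈ᴹ-trans (∙-cong ≈ᴹ-refl (G.vanishes-off (m+1+n≢m q) (∙-homogeneous y∈Hq (π-idem (suc j) u))))
               (∙-zeroʳ _)
    unit : ∀ u v → π p v ∙ g (y ∙ π 0 u) ≈ᴹ (ε (π 0 u) *ₗ π p v) ∙ g y
    unit u v = begin
      π p v ∙ g (y ∙ π 0 u)       ≈⟨ ∙-cong ≈ᴹ-refl (G.cong (∙-π₀ y u)) ⟩
      π p v ∙ g (ε (π 0 u) *ₗ y)  ≈⟨ ∙-cong ≈ᴹ-refl (G.*ₗ-homo _ y) ⟩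
      π p v ∙ (ε (π 0 u) *ₗ g y)  ≈⟨ ∙-scalarʳ _ (π p v) (g y) ⟩
      ε (π 0 u) *ₗ (π p v ∙ g y)  ≈⟨ ∙-scalarˡ _ (π p v) (g y) ⟨
      (ε (π 0 u) *ₗ π p v) ∙ g y  ∎

  smashInner-bottom : ∀ {p g w} → InEndAt p g → Homogeneous p w → ∀ b →
                      mulT (smashInner g (π 0 b)) (Δ w) ≈ᴹ ε (π 0 b) *ₗ g w
  smashInner-bottom {p} {g} {w} g∈End-p w∈Hp b = begin
    mulT (smashInner g (π 0 b)) (Δ w)
      ≈⟨ Δ-single (smashInner-isBilinear G.linear (π 0 b)) w∈Hp p 0 (+-identityʳ p) lower ⟩
    mulT (λ u v → π 0 v ∙ g (π 0 b ∙ π p u)) (Δ w)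
      ≈⟨ mulT-cong unit (Δ w) ⟩
    mulT (λ u v → ε (π 0 b) *ₗ g (ε (π 0 v) *ₗ π p u)) (Δ w)
      ≈⟨ Linear.mulT-homo (∘-isLinear (*ₗ-isLinear (ε (π 0 b))) G.linear) _ (Δ w) ⟨
    ε (π 0 b) *ₗ g (mulT (λ u v → ε (π 0 v) *ₗ π p u) (Δ w))
      ≈⟨ *ₗ-congˡ (G.cong (counitʳ-homogeneous w∈Hp)) ⟩
    ε (π 0 b) *ₗ g w
      ∎
    where
    module G = EndAt g∈End-p
    lower : ∀ j k → j + k ≡ p → j ≢ p → ∀ u v → π k v ∙ g (π 0 b ∙ π j u) ≈ᴹ 0ᴹ
    lower j _ _ j≢p u v =
      ≈ᴹ-trans (∙-cong ≈ᴹ-refl (G.vanishes-off j≢p (∙-homogeneous (π-idem 0 b) (π-idem j u))))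
               (∙-zeroʳ _)
    unit : ∀ u v → π 0 v ∙ g (π 0 b ∙ π p u) ≈ᴹ ε (π 0 b) *ₗ g (ε (π 0 v) *ₗ π p u)
    unit u v = begin
      π 0 v ∙ g (π 0 b ∙ π p u)              ≈⟨ π₀-∙ v _ ⟩
      ε (π 0 v) *ₗ g (π 0 b ∙ π p u)         ≈⟨ *ₗ-congˡ (G.cong (π₀-∙ b (π p u))) ⟩
      ε (π 0 v) *ₗ g (ε (π 0 b) *ₗ π p u)    ≈⟨ *ₗ-congˡ (G.*ₗ-homo _ _) ⟩
      ε (π 0 v) *ₗ (ε (π 0 b) *ₗ g (π p u))  ≈⟨ *ₗ-comm _ _ _ ⟩
      ε (π 0 b) *ₗ (ε (π 0 v) *ₗ g (π p u))  ≈⟨ *ₗ-congˡ (G.*ₗ-homo _ _) ⟨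
      ε (π 0 b) *ₗ g (ε (π 0 v) *ₗ π p u)    ∎

  ✶-absorbs-π : ∀ {p q f g} → InEndAt p f → InEndAt q g → ∀ x → (f ✶ g) (π (p + q) x) ≈ᴹ (f ✶ g) x
  ✶-absorbs-π {p} {q} {f} {g} f∈End-p g∈End-q x =
    ≈ᴹ-trans (proj₁ (proj₂ (✶-inEnd F.inEnd G.inEnd)) (p + q) x)
      (homogeneous-resp (≈ᴹ-sym (✶≈mulT f g x))
        (mulT-homogeneous (λ a b → ∙-homogeneous (F.homogeneous a) (G.homogeneous b)) (Δ x)))
    where
    module F = EndAt f∈End-p
    module G = EndAt g∈End-q

  #-vanishes-outside : ∀ {p q f g} → InEndAt p f → InEndAt q g →
                       ∀ n → (n < p ⊔ q ⊎ p + q < n) → ∀ x → (f # g) (π n x) ≈ᴹ 0ᴹ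
  #-vanishes-outside {p} {q} {f} {g} f∈End-p g∈End-q n outside x =
    ≈ᴹ-trans (#≈mulT-smashForm f g (π n x))
             (Δ-vanishes (smashForm-isBilinear F.linear G.linear) (π-idem n x) term)
    where
    module F = EndAt f∈End-p
    module G = EndAt g∈End-q
    not-inside : ¬ (p ⊔ q ≤ n × n ≤ p + q)
    not-inside (p⊔q≤n , n≤p+q) = [ (λ n<p⊔q → <⇒≱ n<p⊔q p⊔q≤n) , (λ p+q<n → <⇒≱ p+q<n n≤p+q) ] outside
    term : ∀ i l → i + l ≡ n → ∀ a b → smashForm f g (π i a) (π l b) ≈ᴹ 0ᴹ
    term i l i+l≡n a b with i ≟ p
    ... | no i≢p     = smashForm-0ᴹ {f = f} G.linear (F.vanishes-off i≢p (π-idem i a)) (π l b)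
    ... | yes ≡.refl =
      Δ-vanishes (smashInner-isBilinear G.linear (π l b)) (F.homogeneous (π p a)) λ j k j+k≡p u v →
        ≈ᴹ-trans (∙-cong ≈ᴹ-refl (G.vanishes-off (not-inside ∘ smash-degree-bounds {j} {k} i+l≡n j+k≡p)
                                                  (∙-homogeneous (π-idem l b) (π-idem j u))))
                 (∙-zeroʳ _)

  #-top : ∀ {p q f g} → InEndAt p f → InEndAt q g → ∀ x → (f # g) (π (p + q) x) ≈ᴹ (f ✶ g) x
  #-top {p} {q} {f} {g} f∈End-p g∈End-q x = begin
    (f # g) (π n x)                                    ≈⟨ #≈mulT-smashForm f g (π n x) ⟩
    mulT (smashForm f g) (Δ (π n x))
      ≈⟨ Δ-single (smashForm-isBilinear F.linear G.linear) (π-idem n x) p q ≡.refl smash-others ⟩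
    mulT (λ a b → smashForm f g (π p a) (π q b)) (Δ (π n x))
      ≈⟨ mulT-cong (λ a b → smashInner-top g∈End-q (F.homogeneous (π p a)) (π-idem q b)) (Δ (π n x)) ⟩
    mulT (λ a b → f (π p a) ∙ g (π q b)) (Δ (π n x))
      ≈⟨ Δ-single (convolution-isBilinear F.linear G.linear) (π-idem n x) p q ≡.refl convolution-others ⟨
    mulT (λ a b → f a ∙ g b) (Δ (π n x))               ≈⟨ ✶≈mulT f g (π n x) ⟨
    (f ✶ g) (π n x)                                    ≈⟨ ✶-absorbs-π f∈End-p g∈End-q x ⟩
    (f ✶ g) x                                          ∎
    where
    n = p + q
    module F = EndAt f∈End-p
    module G = EndAt g∈End-q
    smash-others : ∀ i l → i + l ≡ n → i ≢ p → ∀ a b → smashForm f g (π i a) (π l b) ≈ᴹ 0ᴹ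
    smash-others i l _ i≢p a b = smashForm-0ᴹ {f = f} G.linear (F.vanishes-off i≢p (π-idem i a)) (π l b)
    convolution-others : ∀ i l → i + l ≡ n → i ≢ p → ∀ a b → f (π i a) ∙ g (π l b) ≈ᴹ 0ᴹ
    convolution-others i l _ i≢p a b =
      ≈ᴹ-trans (∙-cong (F.vanishes-off i≢p (π-idem i a)) ≈ᴹ-refl) (∙-zeroˡ _)

  #-bottom : ∀ {p q f g} → InEndAt p f → InEndAt q g → p ≡ q → ∀ x → (f # g) (π p x) ≈ᴹ g (f x)
  #-bottom {p} {_} {f} {g} f∈End-p g∈End-p ≡.refl x = begin
    (f # g) (π p x)                                           ≈⟨ #≈mulT-smashForm f g (π p x) ⟩
    mulT (smashForm f g) (Δ (π p x))
      ≈⟨ Δ-single (smashForm-isBilinear F.linear G.linear) (π-idem p x) p 0 (+-identityʳ p) others ⟩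
    mulT (λ a b → smashForm f g (π p a) (π 0 b)) (Δ (π p x))
      ≈⟨ mulT-cong (λ a b → smashInner-bottom g∈End-p (F.homogeneous (π p a)) b) (Δ (π p x)) ⟩
    mulT (λ a b → ε (π 0 b) *ₗ g (f (π p a))) (Δ (π p x))
      ≈⟨ mulT-cong (λ a b → ≈ᴹ-sym (Linear.*ₗ-homo g∘f-linear _ _)) (Δ (π p x)) ⟩
    mulT (λ a b → g (f (ε (π 0 b) *ₗ π p a))) (Δ (π p x))     ≈⟨ Linear.mulT-homo g∘f-linear _ (Δ (π p x)) ⟨
    g (f (mulT (λ a b → ε (π 0 b) *ₗ π p a) (Δ (π p x))))
      ≈⟨ G.cong (F.cong (counitʳ-homogeneous (π-idem p x))) ⟩
    g (f (π p x))                                             ≈⟨ G.cong (F.absorbs-π x) ⟩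
    g (f x)                                                   ∎
    where
    module F = EndAt f∈End-p
    module G = EndAt g∈End-p
    g∘f-linear : IsLinear (g ∘ f)
    g∘f-linear = ∘-isLinear G.linear F.linear
    others : ∀ i l → i + l ≡ p → i ≢ p → ∀ a b → smashForm f g (π i a) (π l b) ≈ᴹ 0ᴹ
    others i l _ i≢p a b = smashForm-0ᴹ {f = f} G.linear (F.vanishes-off i≢p (π-idem i a)) (π l b)

proposition2p1 : ∀ {r ℓr m ℓm} (K : CommutativeRing r ℓr) → IsField K →
  (V : Module K m ℓm) (H : IsGradedConnectedHopfAlgebra K V) →
  let open Module V
      open TensorOps K V
      open IsGradedConnectedHopfAlgebra H
      open EndOps K V H
  in (∀ (f g : M → M) → InEnd f → InEnd g →
        InEnd (f ∘ g) × InEnd (f ✶ g) × InEnd (f # g))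
     × (∀ (p q : ℕ) (f g : M → M) → InEndAt p f → InEndAt q g →
        InEnd (f # g)
        × (∀ n → (n < p ⊔ q ⊎ p + q < n) → ∀ x → (f # g) (π n x) ≈ᴹ 0ᴹ)
        × (∀ x → (f # g) (π (p + q) x) ≈ᴹ (f ✶ g) x)
        × (p ≡ q → ∀ x → (f # g) (π p x) ≈ᴹ g (f x)))
proposition2p1 K _ V H =
  (λ f g f∈end g∈end → ∘-inEnd H f∈end g∈end , ✶-inEnd H f∈end g∈end , #-inEnd H f∈end g∈end) ,
  (λ p q f g f∈End-p g∈End-q →
     #-inEnd H (EndAt.inEnd H f∈End-p) (EndAt.inEnd H g∈End-q) ,
     #-vanishes-outside H f∈End-p g∈End-q ,
     #-top H f∈End-p g∈End-q ,
     #-bottom H f∈End-p g∈End-q)
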